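{- For every tree presentation $T$, the lexicographically ordered set $\mathcal{L}_T$ is a linear order of type $T$.
   Context: Tree presentations are finite trees whose nodes are finite sequences of positive integers, each node labelled $\ell$ (leaf), $s$ (sum) or $\sigma$ (shuffle), defined inductively: $1$ is the tree consisting only of the root $\langle\rangle$, labelled $\ell$; if $T_1,\dots,T_k$ ($k\ge 1$) are tree presentations then $s(T_1,\dots,T_k)$ (resp. $\sigma(T_1,\dots,T_k)$) is the tree whose nodes are the root $\langle\rangle$, labelled $s$ (resp. $\sigma$), together with the nodes $\langle i\rangle^\frown t$ for $1\le i\le k$ and $t\in T_i$, labelled as $t$ is in $T_i$. For a sequence $u$ and $i\le|u|$, $u\upharpoonright i$ is its initial segment of length $i$. A linear order has type $T$ if its order type is the value of the expression $T$, where $1$ denotes the one-point order type, $s(\tau_1,\dots,\tau_k)$ is the finite sum $\tau_1+\cdots+\tau_k$ (intervals of types $\tau_1,\dots,\tau_k$ concatenated in this order), and $\sigma(\tau_1,\dots,\tau_k)$ is the shuffle $\sum_{q\in\mathbb{Q}}\tau_q$, where $\mathbb{Q}$ is partitioned into sets $D_1,\dots,D_k$, each dense in $\mathbb{Q}$, and $\tau_q=\tau_i$ for $q\in D_i$. Fix once and for all a partition $\langle\mathbb{Q}_n\rangle_{n\ge1}$ of $\mathbb{Q}$ into sets each dense in $\mathbb{Q}$, with $n\in\mathbb{Q}_n$ for each positive integer $n$. For $q\in\mathbb{Q}$ let $\#(q)$ be the unique $n$ with $q\in\mathbb{Q}_n$, and for a finite sequence of rationals $\bar r=\langle r_0,\dots,r_{m-1}\rangle$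 let $\#(\bar r)=\langle\#(r_0),\dots,\#(r_{m-1})\rangle$. Then $\mathcal{L}_T$ is the set of all finite sequences $\bar r$ of rationals such that $\#(\bar r)$ is a leaf node of $T$ and, for each $i<|\bar r|$, if $\#(\bar r)\upharpoonright i$ is a sum node of $T$ then $r_i=\#(r_i)$; it is ordered lexicographically. -}

module Defs where

open import Data.Nat as ℕ using (ℕ; zero; suc)
open import Data.Fin as Fin using (Fin; toℕ)
open import Data.Integer using (+_)
open import Data.Rational as ℚ using (ℚ; _/_)
open import Data.List using (List; []; _∷_; map; take; length; lookup)
open import Data.Maybe using (Maybe; just; nothing)
open import Data.Product using (Σ; ∃; _×_; _,_)
open import Relation.Binary.PropositionalEquality using (_≡_)
open import Relation.Binary.Core using (Rel)
open import Relation.Unary using (Pred)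
open import Data.List.Relation.Binary.Lex.Strict using (Lex-<)
open import Level using (0ℓ)
open import Relation.Nullary using (yes; no)

-- A node with k children (k ≥ 1) is given by
-- k' and a family of children Fin (suc k') → Tree (k = suc k');
-- child number i (1 ≤ i ≤ k) in the paper is 'Fin.fromℕ (i - 1)' here.
data Tree : Set where
  one : Tree
  s   : (k : ℕ) → (Fin (suc k) → Tree) → Tree
  σ   : (k : ℕ) → (Fin (suc k) → Tree) → Tree

data Label : Set where
  ℓ-leaf s-sum σ-shuffle : Label

-- Nodes are finite sequences of positive integers; 'label T u' is the
-- label of node u in T, or nothing if u is not a node of T.
child : (k : ℕ) → ℕ → Maybe (Fin (suc k))
child k zero    = nothing
child k (suc m) with m ℕ.<? suc k
... | yes p = just (Fin.fromℕ< p)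
... | no _  = nothing

label : Tree → List ℕ → Maybe Label
label one      []      = just ℓ-leaf
label one      (_ ∷ _) = nothing
label (s k Ts) []      = just s-sum
label (s k Ts) (n ∷ u) with child k n
... | just i  = label (Ts i) u
... | nothing = nothing
label (σ k Ts) []      = just σ-shuffle
label (σ k Ts) (n ∷ u) with child k n
... | just i  = label (Ts i) u
... | nothing = nothing

ℕtoℚ : ℕ → ℚ
ℕtoℚ n = (+ n) / 1

-- Assumptions on the fixed partition ⟨ℚ_n⟩_{n≥1} of ℚ, given by
-- # : ℚ → ℕ (q ∈ ℚ_n iff # q ≡ n).
record Partition (# : ℚ → ℕ) : Set where
  field
    positive : ∀ q → 1 ℕ.≤ # q
    dense    : ∀ n → 1 ℕ.≤ n → ∀ p q → p ℚ.< q →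
               ∃ λ r → p ℚ.< r × r ℚ.< q × # r ≡ n
    self     : ∀ n → 1 ℕ.≤ n → # (ℕtoℚ n) ≡ n

𝓛 : (ℚ → ℕ) → Tree → Pred (List ℚ) 0ℓ
𝓛 # T r = label T (map # r) ≡ just ℓ-leaf
        × ((i : Fin (length r)) → label T (take (toℕ i) (map # r)) ≡ just s-sum →
             lookup r i ≡ ℕtoℚ (# (lookup r i)))

_<lex_ : Rel (List ℚ) 0ℓ
_<lex_ = Lex-< _≡_ ℚ._<_

-- "The linearly ordered set (X, <) has type T", for X a subset of an
-- ambient set A ordered by _<_ (the order on X is the restriction).
--  * 1        : X is a single point;
--  * s(T₁…T_k): X splits into k pieces (f a = piece of a), pieces occurring
--               in this order (f monotone), piece i of type T_i;
--  * σ(T₁…T_k): there is a partition d of ℚ into k dense sets D_i = d⁻¹(i)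
--               and a monotone map g : X → ℚ such that X = Σ_{q∈ℚ} g⁻¹(q)
--               with each fibre g⁻¹(q) of type T_{d q}.
HasType : {A : Set} → Rel A 0ℓ → Tree → Pred A 0ℓ → Set
HasType _<_ one X = ∃ λ a → X a × (∀ b → X b → b ≡ a)
HasType {A} _<_ (s k Ts) X =
  Σ (A → Fin (suc k)) λ f →
    (∀ a b → X a → X b → a < b → f a Fin.≤ f b)
  × ((i : Fin (suc k)) → HasType _<_ (Ts i) (λ a → X a × f a ≡ i))
HasType {A} _<_ (σ k Ts) X =
  Σ (ℚ → Fin (suc k)) λ d →
    ((i : Fin (suc k)) → ∀ p q → p ℚ.< q → ∃ λ r → p ℚ.< r × r ℚ.< q × d r ≡ i)
  × Σ (A → ℚ) λ g →
      (∀ a b → X a → X b → a < b → g a ℚ.≤ g b)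
    × ((q : ℚ) → HasType _<_ (Ts (d q)) (λ a → X a × g a ≡ q))

-- Prefixing a fixed rational to all sequences of a set
-- is an order embedding for the lexicographic order, so it preserves the type of the set.
-- At a sum node the head of a sequence is its child number i, and the sequences with head i
-- are i ∷ 𝓛_{T_i}.  At a shuffle node the possible heads form the dense set ℚ₁ ∪ ⋯ ∪ ℚ_k,
-- which is order-isomorphic to ℚ by Cantor's back-and-forth theorem; transporting the
-- classes ℚ_i along the isomorphism gives the required dense partition of ℚ.
-- The isomorphism is constructive: a decidable dense subset of ℚ is arranged in a binary
-- search tree whose node for an interval is its member of least index in an enumeration of
-- ℚ.  Any two such trees have the same shape, and matching their nodes is the isomorphism.

module Submission where

open import Defs
open import Data.Nat using (ℕ)
open import Data.Rational using (ℚ)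
open import Data.List using (List)
open import Data.Product using (_×_)
open import Relation.Binary.PropositionalEquality using (_≡_)
open import Relation.Binary.Structures using (IsStrictTotalOrder)
open import Data.List.Relation.Binary.Pointwise using (Pointwise)

open import Level using (0ℓ)
open import Function using (_∘_; case_of_)
open import Data.Empty using (⊥-elim)
open import Data.Unit using (⊤; tt)
open import Data.Product using (∃; _,_; proj₁; proj₂; uncurry; map₁; map₂)
open import Data.Sum using (inj₁; inj₂)
open import Data.Maybe using (just; nothing; fromMaybe; maybe′)
open import Data.Maybe.Properties using (just-injective)
open import Data.Nat as ℕ using (zero; suc; _+_; z≤n; s≤s)
import Data.Nat.Properties as ℕ
import Data.Nat.Coprimality as Coprime
open import Data.Fin as Fin using (Fin; toℕ; fromℕ; fromℕ<; inject)
import Data.Fin.Properties as Fin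
open import Data.Integer as ℤ using (ℤ; +_; -[1+_]; _⊖_)
import Data.Integer.Properties as ℤ
import Data.Rational as ℚ
import Data.Rational.Properties as ℚ
open import Data.List using ([]; _∷_; drop)
open import Data.List.Relation.Binary.Lex using (toSum)
open import Data.List.Relation.Binary.Lex.Strict using (Lex-<; <-isStrictTotalOrder)
open import Relation.Nullary using (Dec; yes; no; ¬_; ¬?)
open import Relation.Nullary.Decidable using (decidable-stable; _×-dec_)
open import Relation.Nullary.Construct.Add.Extrema using (_±; ⊥±; ⊤±; [_])
open import Relation.Unary using (Pred; Decidable; _≐_)
open import Relation.Unary.Properties using (≐-sym)
open import Relation.Binary.Core using (Rel)
open import Relation.Binary.Definitions using (Irreflexive; tri<; tri≈; tri>)
open import Relation.Binary.PropositionalEquality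
  using (_≢_; refl; sym; trans; cong; subst; subst₂; module ≡-Reasoning)
import Relation.Binary.Construct.Add.Extrema.Strict ℚ._<_ as ℚ±
open ℚ± using (_<±_; ⊥±<[_]; ⊥±<⊤±; [_]<⊤±)

-- Cantor's enumeration of ℕ × ℕ along the diagonals a + b = t; the first triangle t pairs
-- are those on earlier diagonals.
next : ℕ × ℕ → ℕ × ℕ
next (a , zero)  = zero , suc a
next (a , suc b) = suc a , b

unpair : ℕ → ℕ × ℕ
unpair zero    = 0 , 0
unpair (suc n) = next (unpair n)

triangle : ℕ → ℕ
triangle zero    = 0
triangle (suc t) = suc t + triangle t

pair : ℕ → ℕ → ℕ
pair a b = a + triangle (a + b)

unpair-+ : ∀ j {n a b} → unpair n ≡ (a , j + b) → unpair (j + n) ≡ (j + a , b)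
unpair-+ zero    eq = eq
unpair-+ (suc j) {n} {a} {b} eq = begin
  unpair (suc j + n)  ≡⟨ cong unpair (sym (ℕ.+-suc j n)) ⟩
  unpair (j + suc n)  ≡⟨ unpair-+ j (cong next eq) ⟩
  (j + suc a , b)     ≡⟨ cong (_, b) (ℕ.+-suc j a) ⟩
  (suc j + a , b)     ∎
  where open ≡-Reasoning

unpair-triangle : ∀ t → unpair (triangle t) ≡ (0 , t)
unpair-triangle zero    = refl
unpair-triangle (suc t) = cong next (begin
  unpair (t + triangle t)  ≡⟨ unpair-+ t (subst (λ b → unpair (triangle t) ≡ (0 , b))
                                                  (sym (ℕ.+-identityʳ t)) (unpair-triangle t)) ⟩
  (t + 0 , 0)              ≡⟨ cong (_, 0) (ℕ.+-identityʳ t) ⟩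
  (t , 0)                  ∎)
  where open ≡-Reasoning

unpair-pair : ∀ a b → unpair (pair a b) ≡ (a , b)
unpair-pair a b = trans (unpair-+ a (unpair-triangle (a + b))) (cong (_, b) (ℕ.+-identityʳ a))

ℤ-enum : ℕ → ℤ
ℤ-enum n = uncurry _⊖_ (unpair n)

ℤ-index : ℤ → ℕ
ℤ-index (+ n)    = pair n 0
ℤ-index -[1+ n ] = pair 0 (suc n)

ℤ-enum-index : ∀ z → ℤ-enum (ℤ-index z) ≡ z
ℤ-enum-index (+ n)    = cong (uncurry _⊖_) (unpair-pair n 0)
ℤ-enum-index -[1+ n ] = cong (uncurry _⊖_) (unpair-pair 0 (suc n))

ℚ-enum : ℕ → ℚ
ℚ-enum m with unpair m
... | n , d = ℤ-enum n ℚ./ suc d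

ℚ-index : ℚ → ℕ
ℚ-index q = pair (ℤ-index (ℚ.↥ q)) (ℚ.denominator-1 q)

ℚ-enum-index : ∀ q → ℚ-enum (ℚ-index q) ≡ q
ℚ-enum-index q
  rewrite unpair-pair (ℤ-index (ℚ.↥ q)) (ℚ.denominator-1 q)
        | ℤ-enum-index (ℚ.↥ q)
        = ℚ.↥p/↧p≡p q

least-witness : ∀ {P : Pred ℕ 0ℓ} → Decidable P → ∀ {n} → P n →
                ∃ λ m → P m × (∀ {k} → k ℕ.< m → ¬ P k)
least-witness {P} P? {n} pn with Fin.¬∀⟶∃¬-smallest (suc n) (¬_ ∘ P ∘ toℕ) (¬? ∘ P? ∘ toℕ)
                                   (λ none → none (fromℕ n) (subst P (sym (Fin.toℕ-fromℕ n)) pn))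
... | i , ¬¬pi , earlier = toℕ i , decidable-stable (P? (toℕ i)) ¬¬pi , λ k<i pk →
  earlier (fromℕ< k<i) (subst P (sym (trans (Fin.toℕ-inject (fromℕ< k<i)) (Fin.toℕ-fromℕ< k<i))) pk)

0<1 : ℚ.0ℚ ℚ.< ℚ.1ℚ
0<1 = ℚ.positive⁻¹ ℚ.1ℚ

p<p+1 : ∀ p → p ℚ.< p ℚ.+ ℚ.1ℚ
p<p+1 p = subst (ℚ._< p ℚ.+ ℚ.1ℚ) (ℚ.+-identityʳ p) (ℚ.+-monoʳ-< p 0<1)

p-1<p : ∀ p → p ℚ.- ℚ.1ℚ ℚ.< p
p-1<p p = subst (p ℚ.- ℚ.1ℚ ℚ.<_) (ℚ.+-identityʳ p) (ℚ.+-monoʳ-< p (ℚ.neg-antimono-< 0<1))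

record Interval : Set where
  constructor interval
  field
    lo hi    : ℚ ±
    nonempty : lo <± hi

open Interval

_∈ᴵ_ : ℚ → Interval → Set
x ∈ᴵ I = lo I <± [ x ] × [ x ] <± hi I

_∈ᴵ?_ : ∀ x I → Dec (x ∈ᴵ I)
x ∈ᴵ? I = ℚ±.<±-dec ℚ._<?_ (lo I) [ x ] ×-dec ℚ±.<±-dec ℚ._<?_ [ x ] (hi I)

whole : Interval
whole = interval ⊥± ⊤± ⊥±<⊤±

∈-whole : ∀ x → x ∈ᴵ whole
∈-whole x = ⊥±<[ x ] , [ x ]<⊤±

record DecDenseSubset : Set₁ where
  field
    Member  : Pred ℚ 0ℓ
    member? : Decidable Member
    dense   : ∀ {p q} → p ℚ.< q → ∃ λ r → p ℚ.< r × r ℚ.< q × Member r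

  meets : ∀ I → ∃ λ r → r ∈ᴵ I × Member r
  meets (interval _ _ ⊥±<⊤±) =
    let r , _ , _ , m = dense 0<1 in r , (⊥±<[ r ] , [ r ]<⊤±) , m
  meets (interval _ _ ⊥±<[ h ]) =
    let r , _ , r<h , m = dense (p-1<p h) in r , (⊥±<[ r ] , ℚ±.[ r<h ]) , m
  meets (interval _ _ [ l ]<⊤±) =
    let r , l<r , _ , m = dense (p<p+1 l) in r , (ℚ±.[ l<r ] , [ r ]<⊤±) , m
  meets (interval _ _ ℚ±.[ l<h ]) =
    let r , l<r , r<h , m = dense l<h in r , (ℚ±.[ l<r ] , ℚ±.[ r<h ]) , m

module Picking (A : DecDenseSubset) where
  open DecDenseSubset A

  Candidate : Interval → Pred ℕ 0ℓ
  Candidate I n = Member (ℚ-enum n) × ℚ-enum n ∈ᴵ I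

  index-candidate : ∀ {I x} → Member x → x ∈ᴵ I → Candidate I (ℚ-index x)
  index-candidate {I} {x} mx x∈I = subst (λ q → Member q × q ∈ᴵ I) (sym (ℚ-enum-index x)) (mx , x∈I)

  -- Opaque because letting the type checker unfold the search is ruinously slow.
  private opaque
    least-candidate : ∀ I → ∃ λ m → Candidate I m × (∀ {k} → k ℕ.< m → ¬ Candidate I k)
    least-candidate I with meets I
    ... | r , r∈I , mr =
      least-witness {Candidate I} (λ n → member? (ℚ-enum n) ×-dec (ℚ-enum n ∈ᴵ? I))
                    {ℚ-index r} (index-candidate {I} mr r∈I)

  pickIndex : Interval → ℕ
  pickIndex I = proj₁ (least-candidate I)

  pick : Interval → ℚ
  pick I = ℚ-enum (pickIndex I)

  pick-member : ∀ I → Member (pick I)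
  pick-member I = proj₁ (proj₁ (proj₂ (least-candidate I)))

  pick-∈ : ∀ I → pick I ∈ᴵ I
  pick-∈ I = proj₂ (proj₁ (proj₂ (least-candidate I)))

  pickIndex-minimal : ∀ {I n} → Candidate I n → pickIndex I ℕ.≤ n
  pickIndex-minimal {I} c = ℕ.≮⇒≥ λ n<p → proj₂ (proj₂ (least-candidate I)) n<p c

  pickIndex-< : ∀ {I J} → (∀ {x} → x ∈ᴵ J → x ∈ᴵ I) → ¬ pick I ∈ᴵ J →
                pickIndex I ℕ.< pickIndex J
  pickIndex-< {I} {J} J⊆I pick∉J =
    ℕ.≤∧≢⇒< (pickIndex-minimal (pick-member J , J⊆I (pick-∈ J)))
            (λ same → pick∉J (subst (_∈ᴵ J) (cong ℚ-enum (sym same)) (pick-∈ J)))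

  lower upper : Interval → Interval
  lower I = interval (lo I) [ pick I ] (proj₁ (pick-∈ I))
  upper I = interval [ pick I ] (hi I) (proj₂ (pick-∈ I))

  lower-⊆ : ∀ {I x} → x ∈ᴵ lower I → x ∈ᴵ I
  lower-⊆ {I} (lo<x , x<pick) = lo<x , ℚ±.<±-trans ℚ.<-trans x<pick (proj₂ (pick-∈ I))

  upper-⊆ : ∀ {I x} → x ∈ᴵ upper I → x ∈ᴵ I
  upper-⊆ {I} (pick<x , x<hi) = ℚ±.<±-trans ℚ.<-trans (proj₁ (pick-∈ I)) pick<x , x<hi

  pickIndex-lower : ∀ I → pickIndex I ℕ.< pickIndex (lower I)
  pickIndex-lower I = pickIndex-< lower-⊆ λ (_ , c<c) → ℚ.<-irrefl refl (ℚ±.[<]-injective c<c)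

  pickIndex-upper : ∀ I → pickIndex I ℕ.< pickIndex (upper I)
  pickIndex-upper I = pickIndex-< upper-⊆ λ (c<c , _) → ℚ.<-irrefl refl (ℚ±.[<]-injective c<c)

open Picking
open DecDenseSubset using (Member; member?)

-- x and y sit at the same node of the search trees of A below I and of B below J.
data Matched (A B : DecDenseSubset) : Interval → Interval → ℚ → ℚ → Set where
  here  : ∀ {I J} → Matched A B I J (pick A I) (pick B J)
  below : ∀ {I J x y} → x ℚ.< pick A I → Matched A B (lower A I) (lower B J) x y → Matched A B I J x y
  above : ∀ {I J x y} → pick A I ℚ.< x → Matched A B (upper A I) (upper B J) x y → Matched A B I J x y

module _ {A B : DecDenseSubset} where

  Matched-target : ∀ {I J x y} → Matched A B I J x y → Member B y × y ∈ᴵ J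
  Matched-target {J = J} here = pick-member B J , pick-∈ B J
  Matched-target (below _ m) = proj₁ (Matched-target m) , lower-⊆ B (proj₂ (Matched-target m))
  Matched-target (above _ m) = proj₁ (Matched-target m) , upper-⊆ B (proj₂ (Matched-target m))

  target-below : ∀ {I J x y} → Matched A B (lower A I) (lower B J) x y → y ℚ.< pick B J
  target-below m = ℚ±.[<]-injective (proj₂ (proj₂ (Matched-target m)))

  target-above : ∀ {I J x y} → Matched A B (upper A I) (upper B J) x y → pick B J ℚ.< y
  target-above m = ℚ±.[<]-injective (proj₁ (proj₂ (Matched-target m)))

  Matched-flip : ∀ {I J x y} → Matched A B I J x y → Matched B A J I y x
  Matched-flip here        = here
  Matched-flip (below _ m) = below (target-below m) (Matched-flip m)
  Matched-flip (above _ m) = above (target-above m) (Matched-flip m)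

  Matched-functional : ∀ {I J x y y'} → Matched A B I J x y → Matched A B I J x y' → y ≡ y'
  Matched-functional here        here         = refl
  Matched-functional here        (below c<c _) = ⊥-elim (ℚ.<-irrefl refl c<c)
  Matched-functional here        (above c<c _) = ⊥-elim (ℚ.<-irrefl refl c<c)
  Matched-functional (below c<c _) here        = ⊥-elim (ℚ.<-irrefl refl c<c)
  Matched-functional (below _ m) (below _ m')  = Matched-functional m m'
  Matched-functional (below x<c _) (above c<x _) = ⊥-elim (ℚ.<-asym x<c c<x)
  Matched-functional (above c<c _) here        = ⊥-elim (ℚ.<-irrefl refl c<c)
  Matched-functional (above c<x _) (below x<c _) = ⊥-elim (ℚ.<-asym x<c c<x)
  Matched-functional (above _ m) (above _ m')  = Matched-functional m m'

  Matched-mono : ∀ {I J x x' y y'} → Matched A B I J x y → Matched A B I J x' y' →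
                 x ℚ.< x' → y ℚ.< y'
  Matched-mono here          here           c<c   = ⊥-elim (ℚ.<-irrefl refl c<c)
  Matched-mono here          (below x'<c _) c<x'  = ⊥-elim (ℚ.<-asym c<x' x'<c)
  Matched-mono here          (above _ m')   _     = target-above m'
  Matched-mono (below _ m)   here           _     = target-below m
  Matched-mono (below _ m)   (below _ m')   x<x'  = Matched-mono m m' x<x'
  Matched-mono (below _ m)   (above _ m')   _     = ℚ.<-trans (target-below m) (target-above m')
  Matched-mono (above c<x _) here           x<c   = ⊥-elim (ℚ.<-asym c<x x<c)
  Matched-mono (above c<x _) (below x'<c _) x<x'  = ⊥-elim (ℚ.<-asym (ℚ.<-trans c<x x<x') x'<c)
  Matched-mono (above _ m)   (above _ m')   x<x'  = Matched-mono m m' x<x'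

  Matched-exists : ∀ {I J x} → Member A x → x ∈ᴵ I → ∃ (Matched A B I J x)
  Matched-exists {I} {x = x} mx x∈I =
    search (suc (ℚ-index x)) x∈I (s≤s (ℕ.m≤m+n (ℚ-index x) (pickIndex A I)))
    where
    -- Every step down the tree raises pickIndex, which stays ≤ ℚ-index x as long as x is in the interval.
    descend : ∀ {fuel p p'} → ℚ-index x ℕ.< suc fuel + p → p ℕ.< p' → ℚ-index x ℕ.< fuel + p'
    descend {fuel} bound p<p' = ℕ.≤-<-trans (ℕ.≤-pred bound) (ℕ.+-monoʳ-< fuel p<p')

    search : ∀ fuel {I J} → x ∈ᴵ I → ℚ-index x ℕ.< fuel + pickIndex A I → ∃ (Matched A B I J x)
    search zero {I} x∈I bound =
      ⊥-elim (ℕ.<⇒≱ bound (pickIndex-minimal A (index-candidate A {I} mx x∈I)))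
    search (suc fuel) {I} {J} x∈I bound with ℚ.<-cmp x (pick A I)
    ... | tri< x<c _ _ = map₂ (below x<c)
                           (search fuel (proj₁ x∈I , ℚ±.[ x<c ]) (descend bound (pickIndex-lower A I)))
    ... | tri≈ _ refl _ = pick B J , here
    ... | tri> _ _ c<x = map₂ (above c<x)
                           (search fuel (ℚ±.[ c<x ] , proj₂ x∈I) (descend bound (pickIndex-upper A I)))

module _ (A B : DecDenseSubset) where

  match : ℚ → ℚ
  match x with member? A x
  ... | yes mx = proj₁ (Matched-exists {A} {B} {whole} {whole} mx (∈-whole x))
  ... | no _   = x      -- junk outside A

  match-matched : ∀ {x} → Member A x → Matched A B whole whole x (match x)
  match-matched {x} mx with member? A x
  ... | yes mx' = proj₂ (Matched-exists mx' (∈-whole x))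
  ... | no ¬mx  = ⊥-elim (¬mx mx)

record OrderIso (A B : DecDenseSubset) : Set where
  field
    to from     : ℚ → ℚ
    to-member   : ∀ {x} → Member A x → Member B (to x)
    from-member : ∀ {y} → Member B y → Member A (from y)
    from∘to     : ∀ {x} → Member A x → from (to x) ≡ x
    to∘from     : ∀ {y} → Member B y → to (from y) ≡ y
    to-mono     : ∀ {x x'} → Member A x → Member A x' → x ℚ.< x' → to x ℚ.< to x'
    from-mono   : ∀ {y y'} → Member B y → Member B y' → y ℚ.< y' → from y ℚ.< from y'

back-and-forth : ∀ A B → OrderIso A B
back-and-forth A B = record
  { to          = match A B
  ; from        = match B A
  ; to-member   = λ mx → proj₁ (Matched-target (match-matched A B mx))
  ; from-member = λ my → proj₁ (Matched-target (match-matched B A my))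
  ; from∘to     = λ mx → inverse A B mx
  ; to∘from     = λ my → inverse B A my
  ; to-mono     = λ mx mx' → Matched-mono (match-matched A B mx) (match-matched A B mx')
  ; from-mono   = λ my my' → Matched-mono (match-matched B A my) (match-matched B A my')
  }
  where
  inverse : ∀ A B {x} → Member A x → match B A (match A B x) ≡ x
  inverse A B mx = let m = match-matched A B mx in
    Matched-functional (match-matched B A (proj₁ (Matched-target m))) (Matched-flip m)

HasType-resp-≐ : ∀ {A : Set} (_<_ : Rel A 0ℓ) T {X Y : Pred A 0ℓ} →
                 X ≐ Y → HasType _<_ T X → HasType _<_ T Y
HasType-resp-≐ _<_ one (X⊆Y , Y⊆X) (a , xa , unique) = a , X⊆Y xa , λ b yb → unique b (Y⊆X yb)
HasType-resp-≐ _<_ (s k Ts) (X⊆Y , Y⊆X) (f , mono , pieces) =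
  f , (λ a b ya yb → mono a b (Y⊆X ya) (Y⊆X yb)) ,
  λ i → HasType-resp-≐ _<_ (Ts i) (map₁ X⊆Y , map₁ Y⊆X) (pieces i)
HasType-resp-≐ _<_ (σ k Ts) (X⊆Y , Y⊆X) (d , d-dense , g , mono , pieces) =
  d , d-dense , g , (λ a b ya yb → mono a b (Y⊆X ya) (Y⊆X yb)) ,
  λ q → HasType-resp-≐ _<_ (Ts (d q)) (map₁ X⊆Y , map₁ Y⊆X) (pieces q)

Image : {A B : Set} → (A → B) → Pred A 0ℓ → Pred B 0ℓ
Image h X b = ∃ λ a → b ≡ h a × X a

module _ {A : Set} {_≺_ : Rel A 0ℓ} (≺-irrefl : Irreflexive _≡_ _≺_) where

  private
    _<ₗ_ : Rel (List A) 0ℓ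
    _<ₗ_ = Lex-< _≡_ _≺_

    ∷-cancel : ∀ {c b b'} → (c ∷ b) <ₗ (c ∷ b') → b <ₗ b'
    ∷-cancel lt with toSum lt
    ... | inj₁ c≺c      = ⊥-elim (≺-irrefl refl c≺c)
    ... | inj₂ (_ , lt') = lt'

    Image-∷-fibre : ∀ {C : Set} c {X} (f : List A → C) z →
                    Image (c ∷_) (λ a → X a × f a ≡ z) ≐
                    (λ a → Image (c ∷_) X a × f (drop 1 a) ≡ z)
    Image-∷-fibre c f z = (λ { (b , refl , xb , fb) → (b , refl , xb) , fb })
                        , (λ { ((b , refl , xb) , fb) → b , refl , xb , fb })

  HasType-∷ : ∀ c T {X} → HasType _<ₗ_ T X → HasType _<ₗ_ T (Image (c ∷_) X)
  HasType-∷ c one (a , xa , unique) =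
    c ∷ a , (a , refl , xa) , λ { _ (b , refl , xb) → cong (c ∷_) (unique b xb) }
  HasType-∷ c (s k Ts) (f , mono , pieces) =
    f ∘ drop 1 ,
    (λ { _ _ (b , refl , xb) (b' , refl , xb') lt → mono b b' xb xb' (∷-cancel lt) }) ,
    λ i → HasType-resp-≐ _<ₗ_ (Ts i) (Image-∷-fibre c f i) (HasType-∷ c (Ts i) (pieces i))
  HasType-∷ c (σ k Ts) (d , d-dense , g , mono , pieces) =
    d , d-dense , g ∘ drop 1 ,
    (λ { _ _ (b , refl , xb) (b' , refl , xb') lt → mono b b' xb xb' (∷-cancel lt) }) ,
    λ q → HasType-resp-≐ _<ₗ_ (Ts (d q)) (Image-∷-fibre c g q) (HasType-∷ c (Ts (d q)) (pieces q))

branch : (k : ℕ) → ℕ → Fin (suc k)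
branch k n = fromMaybe Fin.zero (child k n)

child-suc-toℕ : ∀ k (i : Fin (suc k)) → child k (suc (toℕ i)) ≡ just i
child-suc-toℕ k i with toℕ i ℕ.<? suc k
... | yes i<k = cong just (Fin.fromℕ<-toℕ i i<k)
... | no  i≮k = ⊥-elim (i≮k (Fin.toℕ<n i))

branch-suc-toℕ : ∀ k (i : Fin (suc k)) → branch k (suc (toℕ i)) ≡ i
branch-suc-toℕ k i = cong (fromMaybe Fin.zero) (child-suc-toℕ k i)

child-just : ∀ k {n i} → child k n ≡ just i → n ≡ suc (toℕ i)
child-just k {suc m} eq with m ℕ.<? suc k
child-just k {suc m} refl | yes m<k = cong suc (sym (Fin.toℕ-fromℕ< m<k))

child-branch : ∀ k {n} → 1 ℕ.≤ n → n ℕ.≤ suc k → child k n ≡ just (branch k n)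
child-branch k {suc m} _ (s≤s m≤k) with m ℕ.<? suc k
... | yes _   = refl
... | no  m≮k = ⊥-elim (m≮k (s≤s m≤k))

ℕtoℚ≡mkℚ : ∀ m → ℕtoℚ m ≡ ℚ.mkℚ (+ m) 0 (Coprime.sym (Coprime.1-coprimeTo m))
ℕtoℚ≡mkℚ m = ℚ.normalize-coprime (Coprime.sym (Coprime.1-coprimeTo m))

ℕtoℚ-cancel-< : ∀ {m n} → ℕtoℚ m ℚ.< ℕtoℚ n → m ℕ.< n
ℕtoℚ-cancel-< {m} {n} lt with subst₂ ℚ._<_ (ℕtoℚ≡mkℚ m) (ℕtoℚ≡mkℚ n) lt
... | ℚ.*<* p = ℤ.drop‿+<+ (subst₂ ℤ._<_ (ℤ.*-identityʳ (+ m)) (ℤ.*-identityʳ (+ n)) p)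

label-∷-s : ∀ k Ts n u → label (s k Ts) (n ∷ u) ≡
                          maybe′ (λ i → label (Ts i) u) nothing (child k n)
label-∷-s k Ts n u with child k n
... | just _  = refl
... | nothing = refl

label-∷-σ : ∀ k Ts n u → label (σ k Ts) (n ∷ u) ≡
                          maybe′ (λ i → label (Ts i) u) nothing (child k n)
label-∷-σ k Ts n u with child k n
... | just _  = refl
... | nothing = refl

module Branching (# : ℚ → ℕ) (T : Tree) (k : ℕ) (Ts : Fin (suc k) → Tree)
                 (label-∷ : ∀ n u → label T (n ∷ u) ≡
                                    maybe′ (λ i → label (Ts i) u) nothing (child k n))
                 (root-not-leaf : label T [] ≢ just ℓ-leaf) where

  HeadCondition : ℚ → Set
  HeadCondition x = label T [] ≡ just s-sum → x ≡ ℕtoℚ (# x)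

  label-child : ∀ {n i} u → child k n ≡ just i → label T (n ∷ u) ≡ label (Ts i) u
  label-child u eq = trans (label-∷ _ u) (cong (maybe′ _ nothing) eq)

  𝓛-[] : ¬ 𝓛 # T []
  𝓛-[] (leaf , _) = root-not-leaf leaf

  𝓛-head : ∀ {x b} → 𝓛 # T (x ∷ b) → HeadCondition x
  𝓛-head (_ , sums) = sums Fin.zero

  𝓛-tail : ∀ {x b} → 𝓛 # T (x ∷ b) → ∃ λ i → child k (# x) ≡ just i × 𝓛 # (Ts i) b
  𝓛-tail {x} {b} (leaf , sums) with child k (# x) in eq
  ... | just i  =
    i , refl , trans (sym (label-child _ eq)) leaf , λ j → sums (Fin.suc j) ∘ trans (label-child _ eq)
  ... | nothing = case trans (sym (trans (label-∷ _ _) (cong (maybe′ _ nothing) eq))) leaf of λ ()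

  𝓛-∷ : ∀ {x b i} → child k (# x) ≡ just i → HeadCondition x → 𝓛 # (Ts i) b → 𝓛 # T (x ∷ b)
  𝓛-∷ eq head (leaf , sums) =
    trans (label-child _ eq) leaf ,
    λ { Fin.zero → head ; (Fin.suc j) → sums j ∘ trans (sym (label-child _ eq)) }

  𝓛-fibre : ∀ {C : Set} (f : List ℚ → C) {z c i} → child k (# c) ≡ just i → HeadCondition c →
            (∀ {x b} → 𝓛 # T (x ∷ b) → f (x ∷ b) ≡ z → x ≡ c) → (∀ b → f (c ∷ b) ≡ z) →
            (λ a → 𝓛 # T a × f a ≡ z) ≐ Image (c ∷_) (𝓛 # (Ts i))
  𝓛-fibre f {z} {c} {i} c-child c-head fibre⇒c c∈fibre =
    fibre⊆ , λ { (b , refl , lb) → 𝓛-∷ c-child c-head lb , c∈fibre b }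
    where
    fibre⊆ : ∀ {a} → 𝓛 # T a × f a ≡ z → Image (c ∷_) (𝓛 # (Ts i)) a
    fibre⊆ {[]}    (l , _)  = ⊥-elim (𝓛-[] l)
    fibre⊆ {x ∷ b} (l , fa) with fibre⇒c l fa | 𝓛-tail l
    ... | refl | j , c-child' , lb =
      b , refl , subst (λ j → 𝓛 # (Ts j) b) (just-injective (trans (sym c-child') c-child)) lb

allℚ : DecDenseSubset
allℚ = record
  { Member  = λ _ → ⊤
  ; member? = λ _ → yes tt
  ; dense   = λ p<q → let r , p<r , r<q = ℚ.<-dense p<q in r , p<r , r<q , tt
  }

HasType-one : ∀ # → HasType _<lex_ one (𝓛 # one)
HasType-one # = [] , (refl , λ ()) , λ { [] _ → refl ; (_ ∷ _) (() , _) }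

module _ (# : ℚ → ℕ) (partition : Partition #) where
  open Partition partition

  summandHead : ∀ {k} → Fin (suc k) → ℚ
  summandHead i = ℕtoℚ (suc (toℕ i))

  HasType-s : ∀ k Ts → (∀ i → HasType _<lex_ (Ts i) (𝓛 # (Ts i))) →
              HasType _<lex_ (s k Ts) (𝓛 # (s k Ts))
  HasType-s k Ts pieces = f , f-mono , λ i →
    HasType-resp-≐ _<lex_ (Ts i) (≐-sym (fibre i))
                   (HasType-∷ ℚ.<-irrefl (summandHead i) (Ts i) (pieces i))
    where
    open Branching # (s k Ts) k Ts (label-∷-s k Ts) (λ ())

    f : List ℚ → Fin (suc k)
    f []      = Fin.zero
    f (x ∷ _) = branch k (# x)

    #summandHead : ∀ i → # (summandHead i) ≡ suc (toℕ i)
    #summandHead i = self _ (s≤s z≤n)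

    head≡summandHead : ∀ {x b} → 𝓛 # (s k Ts) (x ∷ b) → x ≡ summandHead (branch k (# x))
    head≡summandHead {x} l with 𝓛-tail l
    ... | i , x-child , _ = begin
      x                                  ≡⟨ 𝓛-head l refl ⟩
      ℕtoℚ (# x)                         ≡⟨ cong ℕtoℚ (child-just k {# x} x-child) ⟩
      summandHead i                      ≡⟨ cong (summandHead ∘ fromMaybe Fin.zero) (sym x-child) ⟩
      summandHead (branch k (# x))       ∎
      where open ≡-Reasoning

    f-mono : ∀ a b → 𝓛 # (s k Ts) a → 𝓛 # (s k Ts) b → a <lex b → f a Fin.≤ f b
    f-mono []      _       la _  _  = ⊥-elim (𝓛-[] la)
    f-mono (_ ∷ _) []      _  lb _  = ⊥-elim (𝓛-[] lb)
    f-mono (x ∷ _) (y ∷ _) la lb lt with toSum lt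
    ... | inj₂ (refl , _) = ℕ.≤-refl
    ... | inj₁ x<y = ℕ.<⇒≤ (ℕ.s<s⁻¹ (ℕtoℚ-cancel-<
                       (subst₂ ℚ._<_ (head≡summandHead la) (head≡summandHead lb) x<y)))

    fibre : ∀ i → (λ a → 𝓛 # (s k Ts) a × f a ≡ i) ≐ Image (summandHead i ∷_) (𝓛 # (Ts i))
    fibre i = 𝓛-fibre f c-child (λ _ → cong ℕtoℚ (sym (#summandHead i)))
                (λ l fx≡i → trans (head≡summandHead l) (cong summandHead fx≡i))
                (λ _ → cong (fromMaybe Fin.zero) c-child)
      where
      c-child : child k (# (summandHead i)) ≡ just i
      c-child = trans (cong (child k) (#summandHead i)) (child-suc-toℕ k i)

  -- ℚ₁ ∪ ⋯ ∪ ℚ_{k+1}, the possible heads at a shuffle node with k + 1 children.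
  firstClasses : ℕ → DecDenseSubset
  firstClasses k = record
    { Member  = λ q → # q ℕ.≤ suc k
    ; member? = λ q → # q ℕ.≤? suc k
    ; dense   = λ p<q → let r , p<r , r<q , #r≡1 = dense 1 (s≤s z≤n) _ _ p<q
                        in r , p<r , r<q , subst (ℕ._≤ suc k) (sym #r≡1) (s≤s z≤n)
    }

  HasType-σ : ∀ k Ts → (∀ i → HasType _<lex_ (Ts i) (𝓛 # (Ts i))) →
              HasType _<lex_ (σ k Ts) (𝓛 # (σ k Ts))
  HasType-σ k Ts pieces = d , d-dense , g , g-mono , λ q →
    HasType-resp-≐ _<lex_ (Ts (d q)) (≐-sym (fibre q))
                   (HasType-∷ ℚ.<-irrefl (from q) (Ts (d q)) (pieces (d q)))
    where
    open Branching # (σ k Ts) k Ts (label-∷-σ k Ts) (λ ())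
    open OrderIso (back-and-forth (firstClasses k) allℚ)

    d : ℚ → Fin (suc k)
    d q = branch k (# (from q))

    g : List ℚ → ℚ
    g []      = ℚ.0ℚ
    g (x ∷ _) = to x

    head-member : ∀ {x b} → 𝓛 # (σ k Ts) (x ∷ b) → # x ℕ.≤ suc k
    head-member l with 𝓛-tail l
    ... | i , x-child , _ = subst (ℕ._≤ suc k) (sym (child-just k x-child)) (Fin.toℕ<n i)

    d-dense : ∀ i p q → p ℚ.< q → ∃ λ r → p ℚ.< r × r ℚ.< q × d r ≡ i
    d-dense i p q p<q with dense (suc (toℕ i)) (s≤s z≤n) (from p) (from q) (from-mono tt tt p<q)
    ... | r , fp<r , r<fq , #r =
      to r , subst (ℚ._< to r) (to∘from {p} tt) (to-mono (from-member {p} tt) r-member fp<r)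
           , subst (to r ℚ.<_) (to∘from {q} tt) (to-mono r-member (from-member {q} tt) r<fq)
           , d[to-r]≡i
      where
      r-member : # r ℕ.≤ suc k
      r-member = subst (ℕ._≤ suc k) (sym #r) (Fin.toℕ<n i)

      d[to-r]≡i : d (to r) ≡ i
      d[to-r]≡i = begin
        branch k (# (from (to r)))  ≡⟨ cong (branch k ∘ #) (from∘to r-member) ⟩
        branch k (# r)              ≡⟨ cong (branch k) #r ⟩
        branch k (suc (toℕ i))      ≡⟨ branch-suc-toℕ k i ⟩
        i                           ∎
        where open ≡-Reasoning

    g-mono : ∀ a b → 𝓛 # (σ k Ts) a → 𝓛 # (σ k Ts) b → a <lex b → g a ℚ.≤ g b
    g-mono []      _       la _  _  = ⊥-elim (𝓛-[] la)
    g-mono (_ ∷ _) []      _  lb _  = ⊥-elim (𝓛-[] lb)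
    g-mono (x ∷ _) (y ∷ _) la lb lt with toSum lt
    ... | inj₂ (refl , _) = ℚ.≤-refl
    ... | inj₁ x<y = ℚ.<⇒≤ (to-mono (head-member la) (head-member lb) x<y)

    fibre : ∀ q → (λ a → 𝓛 # (σ k Ts) a × g a ≡ q) ≐ Image (from q ∷_) (𝓛 # (Ts (d q)))
    fibre q = 𝓛-fibre g (child-branch k (positive (from q)) (from-member {q} tt)) (λ ())
                (λ l gx≡q → trans (sym (from∘to (head-member l))) (cong from gx≡q))
                (λ _ → to∘from {q} tt)

  HasType-𝓛 : ∀ T → HasType _<lex_ T (𝓛 # T)
  HasType-𝓛 one      = HasType-one #
  HasType-𝓛 (s k Ts) = HasType-s k Ts (λ i → HasType-𝓛 (Ts i))
  HasType-𝓛 (σ k Ts) = HasType-σ k Ts (λ i → HasType-𝓛 (Ts i))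

proposition3 : (# : ℚ → ℕ) → Partition # → (T : Tree) →
    IsStrictTotalOrder (Pointwise _≡_) _<lex_ × HasType _<lex_ T (𝓛 # T)
proposition3 # partition T = <-isStrictTotalOrder ℚ.<-isStrictTotalOrder , HasType-𝓛 # partition T
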